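{- Let $q$ be a prime power and let $\mathcal{F}=\mathcal{F}(f,g,h)$ be a flock of $PG(3,q)$ with coordinate functions $f,g,h$. Then $\mathcal{F}$ is a star flock (i.e. all its planes contain a common point) if and only if the functions $f,g,h\colon GF(q)\to GF(q)$ are linearly dependent over $GF(q)$.
   Context: In $PG(3,q)$ with homogeneous coordinates $(x_0,x_1,x_2,x_3)$, let $V=(0,0,0,1)$. For $f,g,h\colon GF(q)\to GF(q)$ with $f(0)=g(0)=h(0)=0$, $\mathcal{F}(f,g,h)$ denotes the set of planes $\pi_t\colon f(t)x_0+g(t)x_1+h(t)x_2-x_3=0$, $t\in GF(q)$; it is called a flock when these $q$ planes are distinct, and $f,g,h$ are its coordinate functions. -}

module Defs where

open import Level using (Level; _⊔_)
open import Algebra.Bundles using (CommutativeRing)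
open import Data.Fin using (Fin; zero; suc)
open import Data.List using (List)
open import Data.List.Relation.Unary.Any using (Any)
open import Data.Product using (Σ; ∃; _×_; _,_)
open import Relation.Nullary using (¬_)
open import Function.Definitions using (Congruent)

record IsField {c ℓ} (R : CommutativeRing c ℓ) : Set (c ⊔ ℓ) where
  open CommutativeRing R hiding (zero)
  field
    1≉0     : ¬ (1# ≈ 0#)
    inverse : ∀ x → ¬ (x ≈ 0#) → ∃ λ y → (x * y) ≈ 1#

IsFinite : ∀ {c ℓ} (R : CommutativeRing c ℓ) → Set (c ⊔ ℓ)
IsFinite R = ∃ λ (xs : List Carrier) → ∀ x → Any (x ≈_) xs
  where open CommutativeRing R

module Geometry {c ℓ} (R : CommutativeRing c ℓ) where
  open CommutativeRing R hiding (zero)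

  -- homogeneous coordinate vectors of length 4 (points or planes of PG(3,F))
  V4 : Set c
  V4 = Fin 4 → Carrier

  vec4 : Carrier → Carrier → Carrier → Carrier → V4
  vec4 a b d e zero = a
  vec4 a b d e (suc zero) = b
  vec4 a b d e (suc (suc zero)) = d
  vec4 a b d e (suc (suc (suc zero))) = e

  NonZeroV : V4 → Set ℓ
  NonZeroV u = ¬ (∀ i → u i ≈ 0#)

  SamePlane : V4 → V4 → Set (c ⊔ ℓ)
  SamePlane u v = ∃ λ k → ¬ (k ≈ 0#) × (∀ i → u i ≈ k * v i)

  Incident : V4 → V4 → Set ℓ
  Incident p u =
    (u zero * p zero + u (suc zero) * p (suc zero)
      + u (suc (suc zero)) * p (suc (suc zero))
      + u (suc (suc (suc zero))) * p (suc (suc (suc zero)))) ≈ 0#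

  plane : (f g h : Carrier → Carrier) → Carrier → V4
  plane f g h t = vec4 (f t) (g t) (h t) (- 1#)

  IsFlock : (f g h : Carrier → Carrier) → Set (c ⊔ ℓ)
  IsFlock f g h = ∀ s t → ¬ (s ≈ t) → ¬ SamePlane (plane f g h s) (plane f g h t)

  IsStarFlock : (f g h : Carrier → Carrier) → Set (c ⊔ ℓ)
  IsStarFlock f g h = ∃ λ p → NonZeroV p × (∀ t → Incident p (plane f g h t))

  LinDep : (f g h : Carrier → Carrier) → Set (c ⊔ ℓ)
  LinDep f g h = ∃ λ a → ∃ λ b → ∃ λ d →
    ¬ (a ≈ 0# × b ≈ 0# × d ≈ 0#) × (∀ t → (a * f t + b * g t + d * h t) ≈ 0#)

-- The plane π₀ is x₃ = 0, so the common point p of a star flock has p₃ = 0;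
-- for such a point, lying on π_t says exactly p₀ f(t) + p₁ g(t) + p₂ h(t) = 0.
-- Hence the vertices of the star are precisely the nontrivial linear relations
-- (p₀, p₁, p₂) among f, g, h.  The argument works over any commutative ring.
module Submission where

open import Defs
open import Algebra.Bundles using (CommutativeRing)
open import Function.Bundles using (_⇔_; mk⇔; Equivalence)
open import Function.Definitions using (Congruent)
open import Data.Fin using (zero; suc)
open import Data.Product using (_,_; _×_)
open import Relation.Nullary using (¬_)
import Algebra.Properties.Ring as RingProperties
import Relation.Binary.Reasoning.Setoid as SetoidReasoning

module StarFlocks {c ℓ} (R : CommutativeRing c ℓ) where
  open CommutativeRing R hiding (zero)
  open Geometry R
  open RingProperties ring using (-1*x≈-x; x∙y⁻¹≈ε⇒x≈y; x≈y⇒x∙y⁻¹≈ε)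
  open SetoidReasoning setoid

  linComb : Carrier → Carrier → Carrier → (f g h : Carrier → Carrier) → Carrier → Carrier
  linComb a b d f g h t = a * f t + b * g t + d * h t

  module _ (f g h : Carrier → Carrier) (p : V4) where
    private
      p₀ p₁ p₂ p₃ : Carrier
      p₀ = p zero
      p₁ = p (suc zero)
      p₂ = p (suc (suc zero))
      p₃ = p (suc (suc (suc zero)))

    incidence-plane≈ : ∀ t →
      f t * p₀ + g t * p₁ + h t * p₂ + - 1# * p₃ ≈ linComb p₀ p₁ p₂ f g h t - p₃
    incidence-plane≈ t =
      +-cong (+-cong (+-cong (*-comm (f t) p₀) (*-comm (g t) p₁)) (*-comm (h t) p₂))
             (-1*x≈-x p₃)

    incident-plane⇔ : ∀ t → Incident p (plane f g h t) ⇔ (linComb p₀ p₁ p₂ f g h t ≈ p₃)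
    incident-plane⇔ t = mk⇔
      (λ inc → x∙y⁻¹≈ε⇒x≈y _ _ (trans (sym (incidence-plane≈ t)) inc))
      (λ eq → trans (incidence-plane≈ t) (x≈y⇒x∙y⁻¹≈ε eq))

  linComb-vanishes : ∀ a b d (f g h : Carrier → Carrier) {t} →
    f t ≈ 0# → g t ≈ 0# → h t ≈ 0# → linComb a b d f g h t ≈ 0#
  linComb-vanishes a b d f g h {t} f0 g0 h0 = begin
    a * f t + b * g t + d * h t ≈⟨ +-cong (+-cong (*-congˡ f0) (*-congˡ g0)) (*-congˡ h0) ⟩
    a * 0# + b * 0# + d * 0#    ≈⟨ +-cong (+-cong (zeroʳ a) (zeroʳ b)) (zeroʳ d) ⟩
    0# + 0# + 0#                ≈⟨ trans (+-identityʳ _) (+-identityʳ _) ⟩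
    0#                          ∎

  isStarFlock⇔linDep : (f g h : Carrier → Carrier) →
    f 0# ≈ 0# → g 0# ≈ 0# → h 0# ≈ 0# →
    IsStarFlock f g h ⇔ LinDep f g h
  isStarFlock⇔linDep f g h f0 g0 h0 = mk⇔ star⇒linDep linDep⇒star
    where
    star⇒linDep : IsStarFlock f g h → LinDep f g h
    star⇒linDep (p , p≉0 , incident) =
      p zero , p (suc zero) , p (suc (suc zero)) , coefficients≉0 , relation
      where
      on-plane : ∀ t → linComb (p zero) (p (suc zero)) (p (suc (suc zero))) f g h t
                         ≈ p (suc (suc (suc zero)))
      on-plane t = Equivalence.to (incident-plane⇔ f g h p t) (incident t)

      p₃≈0 : p (suc (suc (suc zero))) ≈ 0#
      p₃≈0 = trans (sym (on-plane 0#)) (linComb-vanishes _ _ _ f g h f0 g0 h0)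

      relation : ∀ t → linComb (p zero) (p (suc zero)) (p (suc (suc zero))) f g h t ≈ 0#
      relation t = trans (on-plane t) p₃≈0

      coefficients≉0 : ¬ (p zero ≈ 0# × p (suc zero) ≈ 0# × p (suc (suc zero)) ≈ 0#)
      coefficients≉0 (p₀≈0 , p₁≈0 , p₂≈0) = p≉0 λ
        { zero → p₀≈0 ; (suc zero) → p₁≈0 ; (suc (suc zero)) → p₂≈0
        ; (suc (suc (suc zero))) → p₃≈0 }

    linDep⇒star : LinDep f g h → IsStarFlock f g h
    linDep⇒star (a , b , d , coefficients≉0 , relation) =
      vec4 a b d 0# , vertex≉0 , λ t → Equivalence.from (incident-plane⇔ f g h (vec4 a b d 0#) t) (relation t)
      where
      vertex≉0 : NonZeroV (vec4 a b d 0#)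
      vertex≉0 all≈0 = coefficients≉0 (all≈0 zero , all≈0 (suc zero) , all≈0 (suc (suc zero)))

theorem3p2 : ∀ {c ℓ} (R : CommutativeRing c ℓ) → IsField R → IsFinite R →
    let open CommutativeRing R in let open Geometry R in
    (f g h : Carrier → Carrier) →
    Congruent _≈_ _≈_ f → Congruent _≈_ _≈_ g → Congruent _≈_ _≈_ h →
    f 0# ≈ 0# → g 0# ≈ 0# → h 0# ≈ 0# →
    IsFlock f g h →
    (IsStarFlock f g h ⇔ LinDep f g h)
theorem3p2 R _ _ f g h _ _ _ f0 g0 h0 _ = StarFlocks.isStarFlock⇔linDep R f g h f0 g0 h0
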